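{- Let $p$ be an odd prime. For every point $(E,\{A,B\})$ of $X_{\mathrm{sp}}^+$ (non-cuspidal), $$\alpha\circ\alpha\,(E,\{A,B\})=\frac{p-1}{2}\cdot(E,\{A,B\})+\sum_{\{C,D\}}(E,\{C,D\}),$$ where the sum runs over all unordered pairs $\{C,D\}$ of distinct pearls such that the cross-ratio $[A,B;C,D]$ is defined and is a square in $\mathbb{F}_p^\times$.
   Context: For an elliptic curve $E$ over an algebraically closed field of characteristic $\ne p$, pearls are cyclic subgroups of order $p$ of $E[p]$, i.e. points of $\mathbb{P}(E[p])$. For distinct $A,B,C$ and any $D$, $[A,B;C,D]=f(D)$ where $f:\mathbb{P}(E[p])\to\mathbb{P}^1(\mathbb{F}_p)$ is the unique projective isomorphism with $f(A)=(1:0)$, $f(B)=(0:1)$, $f(C)=(1:1)$. Non-cuspidal points of $X_{\mathrm{sp}}^+$ (quotient of $X(p)$ by the normaliser of a split Cartan subgroup) are classes $(E,\{A,B\})$ with $A\ne B$ pearls. The map $\alpha$ on divisors of $X_{\mathrm{sp}}^+$ is defined by $\alpha(E,\{A,B\})=\sum(E,\{C,D\})$ over all unordered pairs $\{C,D\}$ with $[A,B;C,D]=-1$. -}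

module Defs where

open import Data.Nat as ℕ using (ℕ; zero; suc)
open import Data.Nat.Divisibility using (_∣_; _∣?_)
open import Data.Integer as ℤ using (ℤ; +_; ∣_∣)
open import Data.Fin using (Fin; toℕ) renaming (zero to fzero; suc to fsuc)
open import Data.Fin.Properties using (_≟_; _<?_)
open import Data.Product using (_×_; _,_; ∃)
open import Data.Sum using (_⊎_)
open import Data.Bool using (Bool; true; false; if_then_else_; _∧_; not)
open import Relation.Nullary using (¬_; does)
open import Relation.Binary.PropositionalEquality using (_≡_)

-- Pearls: the points of P(E[p]) ≅ P^1(F_p), enumerated as Fin (suc p):
--   zero    ↦ (1 : 0)   (the point at infinity)
--   suc i   ↦ (i : 1)   for i = 0, …, p-1.
Pearl : ℕ → Set
Pearl p = Fin (suc p)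

coord : {p : ℕ} → Pearl p → ℤ × ℤ
coord fzero   = (+ 1 , + 0)
coord (fsuc i) = (+ toℕ i , + 1)

det : ℤ × ℤ → ℤ × ℤ → ℤ
det (x₁ , x₂) (y₁ , y₂) = x₁ ℤ.* y₂ ℤ.- x₂ ℤ.* y₁

_≡0[_] : ℤ → ℕ → Set
x ≡0[ p ] = p ∣ ∣ x ∣

isZero : ℕ → ℤ → Bool
isZero p x = does (p ∣? ∣ x ∣)

-- The unique projective isomorphism f with f(A) = (1:0), f(B) = (0:1),
-- f(C) = (1:1) (A, B, C distinct) is induced by the linear map
--   d ↦ ( det(c,a)·det(d,b) , det(c,b)·det(d,a) ).
-- [A,B;C,D] = f(D), given in homogeneous coordinates (num : den).
crNum : {p : ℕ} → Pearl p → Pearl p → Pearl p → Pearl p → ℤ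
crNum A B C D = det (coord C) (coord A) ℤ.* det (coord D) (coord B)

crDen : {p : ℕ} → Pearl p → Pearl p → Pearl p → Pearl p → ℤ
crDen A B C D = det (coord C) (coord B) ℤ.* det (coord D) (coord A)

distinct3 : {p : ℕ} → Pearl p → Pearl p → Pearl p → Bool
distinct3 A B C = not (does (A ≟ B)) ∧ not (does (A ≟ C)) ∧ not (does (B ≟ C))

-- [A,B;C,D] is defined and equals -1 = (-1 : 1) in P^1(F_p)
harmonic : (p : ℕ) → Pearl p → Pearl p → Pearl p → Pearl p → Bool
harmonic p A B C D =
  distinct3 A B C ∧ not (isZero p (crDen A B C D))
                  ∧ isZero p (crNum A B C D ℤ.+ crDen A B C D)

CRSquare : (p : ℕ) → Pearl p → Pearl p → Pearl p → Pearl p → Set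
CRSquare p A B C D =
  distinct3 A B C ≡ true × ¬ (crNum A B C D ≡0[ p ]) × ¬ (crDen A B C D ≡0[ p ])
  × ∃ λ (t : ℤ) → (t ℤ.* t ℤ.* crDen A B C D ℤ.- crNum A B C D) ≡0[ p ]

SquarePair : (p : ℕ) → Pearl p → Pearl p → Pearl p → Pearl p → Set
SquarePair p A B C D = CRSquare p A B C D ⊎ CRSquare p A B D C

sumFin : (n : ℕ) → (Fin n → ℕ) → ℕ
sumFin zero    f = 0
sumFin (suc n) f = f fzero ℕ.+ sumFin n (λ i → f (fsuc i))

-- Unordered pairs {C,D} of distinct pearls are represented by C < D.
-- Coefficient of (E,{C,D}) in α(E,{A,B}).
alphaCoeff : (p : ℕ) → Pearl p → Pearl p → Pearl p → Pearl p → ℕ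
alphaCoeff p A B C D = if harmonic p A B C D then 1 else 0

-- Coefficient of (E,{R,S}) in α(α(E,{A,B})), α extended linearly to divisors.
alpha2Coeff : (p : ℕ) → Pearl p → Pearl p → Pearl p → Pearl p → ℕ
alpha2Coeff p A B R S =
  sumFin (suc p) λ C → sumFin (suc p) λ D →
    if does (C <? D) then alphaCoeff p A B C D ℕ.* alphaCoeff p C D R S else 0

{-# OPTIONS --safe #-}
-- Doubling α∘α counts ordered pairs (C, D) instead of unordered ones.  For a pearl
-- C ∉ {A, B} exactly one D is harmonic to C with respect to A, B (its harmonic conjugate), so
-- twice the coefficient of {R, S} is the number of C ∉ {A, B} for which {C, D} is harmonic with
-- respect to R, S, i.e. the number of zeros outside {A, B} of a binary quadratic form.
-- If {R, S} = {A, B} this form vanishes identically, giving p − 1.  Otherwise a zero C yields a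
-- square root of [A, B; R, S], and conversely a square root t splits the form into two distinct
-- linear factors, so it has exactly two zeros.

module Submission where

open import Defs
open import Data.Nat using (ℕ; suc; _∸_; _/_; _%_)
open import Data.Nat.Primality using (Prime)
open import Data.Fin using (Fin; _<_)
open import Data.Product using (_×_)
open import Relation.Nullary using (¬_)
open import Relation.Binary.PropositionalEquality using (_≡_)

import Data.Nat as ℕ
open import Data.Nat using (zero; s≤s)
import Data.Nat.Properties as ℕₚ
open import Data.Nat.DivMod using (m*n/n≡m)
import Data.Nat.Divisibility as ℕᵈ
open import Data.Nat.Primality using (euclidsLemma; prime⇒irreducible; prime⇒nonZero; ¬prime[0]; ¬prime[1])
open import Data.Nat.Coprimality using (Coprime; coprime-Bézout)
open import Data.Nat.GCD using (module Bézout)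
open import Data.Fin using (zero; suc; toℕ; fromℕ<)
open import Data.Fin.Properties using (_≟_; _<?_; <-cmp; <-asym; <⇒≢; toℕ<n; toℕ-injective; toℕ-fromℕ<)
open import Data.Bool using (if_then_else_)
open import Data.Product using (Σ-syntax; ∃-syntax; _,_; proj₁; proj₂)
open import Data.Sum as Sum using (_⊎_; inj₁; inj₂)
open import Function using (_∘_; id; flip)
open import Function.Bundles using (_⇔_; mk⇔; Equivalence)
open import Function.Properties.Equivalence using () renaming (trans to ⇔-trans; sym to ⇔-sym)
open import Relation.Nullary using (Dec; yes; no; does; contradiction; ¬?; _×-dec_)
open import Relation.Nullary.Decidable using (dec-true; dec-false)
open import Relation.Unary using (Decidable)
open import Relation.Binary.Definitions using (tri<; tri≈; tri>)
open import Relation.Binary.PropositionalEquality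
  using (refl; sym; trans; cong; cong₂; subst; subst₂; _≢_; module ≡-Reasoning)
open import Algebra.Properties.Semiring.Sum ℕₚ.+-*-semiring
  using (sum; sum-syntax; sum-cong-≗; ∑-comm; ∑-distrib-+; sum-replicate-zero)

open Equivalence using (to; from)

module FiniteSums where

  open import Data.Nat using (_+_; _*_)

  𝟙 : {P : Set} → Dec P → ℕ
  𝟙 P? = if does P? then 1 else 0

  𝟙-yes : {P : Set} (P? : Dec P) → P → 𝟙 P? ≡ 1
  𝟙-yes (yes _) _ = refl
  𝟙-yes (no ¬p) p = contradiction p ¬p

  𝟙-no : {P : Set} (P? : Dec P) → ¬ P → 𝟙 P? ≡ 0
  𝟙-no (yes p) ¬p = contradiction p ¬p
  𝟙-no (no _) _ = refl

  𝟙-cong : {P Q : Set} (P? : Dec P) (Q? : Dec Q) → P ⇔ Q → 𝟙 P? ≡ 𝟙 Q?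
  𝟙-cong P? (yes q) P⇔Q = 𝟙-yes P? (from P⇔Q q)
  𝟙-cong P? (no ¬q) P⇔Q = 𝟙-no P? (¬q ∘ to P⇔Q)

  sumFin≡sum : ∀ n (f : Fin n → ℕ) → sumFin n f ≡ sum f
  sumFin≡sum zero f = refl
  sumFin≡sum (suc n) f = cong (f zero +_) (sumFin≡sum n (f ∘ suc))

  ∑-const-1 : ∀ n → ∑[ i < n ] 1 ≡ n
  ∑-const-1 zero = refl
  ∑-const-1 (suc n) = cong suc (∑-const-1 n)

  ∑-zero : ∀ {n} {f : Fin n → ℕ} → (∀ i → f i ≡ 0) → ∑[ i < n ] f i ≡ 0
  ∑-zero {n} f≡0 = trans (sum-cong-≗ f≡0) (sum-replicate-zero n)

  ∑-𝟙-≟-* : ∀ {n} (X : Fin n) (f : Fin n → ℕ) → ∑[ i < n ] (𝟙 (i ≟ X) * f i) ≡ f X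
  ∑-𝟙-≟-* {suc n} zero f =
    trans (cong₂ _+_ (ℕₚ.+-identityʳ (f zero)) (sum-replicate-zero n)) (ℕₚ.+-identityʳ (f zero))
  ∑-𝟙-≟-* {suc n} (suc X) f = ∑-𝟙-≟-* X (f ∘ suc)

  ∑-𝟙-≟ : ∀ {n} (X : Fin n) → ∑[ i < n ] 𝟙 (i ≟ X) ≡ 1
  ∑-𝟙-≟ {n} X = trans (sum-cong-≗ (λ i → sym (ℕₚ.*-identityʳ (𝟙 (i ≟ X))))) (∑-𝟙-≟-* X (λ _ → 1))

  module _ {n : ℕ} {P : Fin n → Set} (P? : Decidable P) where

    ∑-𝟙-empty : (∀ i → ¬ P i) → ∑[ i < n ] 𝟙 (P? i) ≡ 0
    ∑-𝟙-empty ¬P = ∑-zero (λ i → 𝟙-no (P? i) (¬P i))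

    ∑-𝟙-pair : ∀ {U V} → U ≢ V → (∀ i → P i ⇔ (i ≡ U ⊎ i ≡ V)) → ∑[ i < n ] 𝟙 (P? i) ≡ 2
    ∑-𝟙-pair {U} {V} U≢V P⇔ = begin
      ∑[ i < n ] 𝟙 (P? i)                       ≡⟨ sum-cong-≗ split ⟩
      ∑[ i < n ] (𝟙 (i ≟ U) + 𝟙 (i ≟ V))        ≡⟨ ∑-distrib-+ (λ i → 𝟙 (i ≟ U)) (λ i → 𝟙 (i ≟ V)) ⟩
      ∑[ i < n ] 𝟙 (i ≟ U) + ∑[ i < n ] 𝟙 (i ≟ V) ≡⟨ cong₂ _+_ (∑-𝟙-≟ U) (∑-𝟙-≟ V) ⟩
      2                                           ∎
      where
      open ≡-Reasoning
      split : ∀ i → 𝟙 (P? i) ≡ 𝟙 (i ≟ U) + 𝟙 (i ≟ V)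
      split i with i ≟ U | i ≟ V
      ... | yes refl | yes refl = contradiction refl U≢V
      ... | yes i≡U  | no _     = 𝟙-yes (P? i) (from (P⇔ i) (inj₁ i≡U))
      ... | no _     | yes i≡V  = 𝟙-yes (P? i) (from (P⇔ i) (inj₂ i≡V))
      ... | no i≢U   | no i≢V   = 𝟙-no (P? i) (Sum.[ i≢U , i≢V ] ∘ to (P⇔ i))

    ∑-𝟙-all-but-pair : ∀ {A B} → A ≢ B → (∀ i → P i ⇔ (i ≢ A × i ≢ B)) → ∑[ i < n ] 𝟙 (P? i) ≡ n ∸ 2
    ∑-𝟙-all-but-pair {A} {B} A≢B P⇔ = begin
      ∑[ i < n ] 𝟙 (P? i)         ≡⟨ ℕₚ.m+n∸n≡m _ 2 ⟨
      ∑[ i < n ] 𝟙 (P? i) + 2 ∸ 2 ≡⟨ cong (_∸ 2) total ⟩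
      n ∸ 2                       ∎
      where
      open ≡-Reasoning
      partition : ∀ i → 𝟙 (P? i) + (𝟙 (i ≟ A) + 𝟙 (i ≟ B)) ≡ 1
      partition i with i ≟ A | i ≟ B
      ... | yes refl | yes refl = contradiction refl A≢B
      ... | yes i≡A  | no _     = cong (_+ 1) (𝟙-no (P? i) (λ Pi → proj₁ (to (P⇔ i) Pi) i≡A))
      ... | no _     | yes i≡B  = cong (_+ 1) (𝟙-no (P? i) (λ Pi → proj₂ (to (P⇔ i) Pi) i≡B))
      ... | no i≢A   | no i≢B   = cong (_+ 0) (𝟙-yes (P? i) (from (P⇔ i) (i≢A , i≢B)))
      total : ∑[ i < n ] 𝟙 (P? i) + 2 ≡ n
      total = begin
        ∑[ i < n ] 𝟙 (P? i) + 2
          ≡⟨ cong (∑[ i < n ] 𝟙 (P? i) +_) (cong₂ _+_ (∑-𝟙-≟ A) (∑-𝟙-≟ B)) ⟨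
        ∑[ i < n ] 𝟙 (P? i) + (∑[ i < n ] 𝟙 (i ≟ A) + ∑[ i < n ] 𝟙 (i ≟ B))
          ≡⟨ cong (∑[ i < n ] 𝟙 (P? i) +_) (∑-distrib-+ (λ i → 𝟙 (i ≟ A)) (λ i → 𝟙 (i ≟ B))) ⟨
        ∑[ i < n ] 𝟙 (P? i) + ∑[ i < n ] (𝟙 (i ≟ A) + 𝟙 (i ≟ B))
          ≡⟨ ∑-distrib-+ (λ i → 𝟙 (P? i)) (λ i → 𝟙 (i ≟ A) + 𝟙 (i ≟ B)) ⟨
        ∑[ i < n ] (𝟙 (P? i) + (𝟙 (i ≟ A) + 𝟙 (i ≟ B)))
          ≡⟨ sum-cong-≗ partition ⟩
        ∑[ i < n ] 1
          ≡⟨ ∑-const-1 n ⟩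
        n ∎

  upper : ∀ {n} → (Fin n → Fin n → ℕ) → Fin n → Fin n → ℕ
  upper g i j = if does (i <? j) then g i j else 0

  ∑∑-upper : ∀ {n} (g : Fin n → Fin n → ℕ) → (∀ i j → g i j ≡ g j i) → (∀ i → g i i ≡ 0) →
             2 * ∑[ i < n ] ∑[ j < n ] upper g i j ≡ ∑[ i < n ] ∑[ j < n ] g i j
  ∑∑-upper {n} g g-sym g-diag = sym (begin
    ∑[ i < n ] ∑[ j < n ] g i j
      ≡⟨ sum-cong-≗ (λ i → trans (sum-cong-≗ (split i)) (∑-distrib-+ (upper g i) (λ j → upper g j i))) ⟩
    ∑[ i < n ] (∑[ j < n ] upper g i j + ∑[ j < n ] upper g j i)
      ≡⟨ ∑-distrib-+ (λ i → ∑[ j < n ] upper g i j) (λ i → ∑[ j < n ] upper g j i) ⟩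
    S + ∑[ i < n ] ∑[ j < n ] upper g j i
      ≡⟨ cong (S +_) (∑-comm (λ i j → upper g j i)) ⟩
    S + S
      ≡⟨ cong (S +_) (ℕₚ.+-identityʳ S) ⟨
    2 * S ∎)
    where
    open ≡-Reasoning
    S = ∑[ i < n ] ∑[ j < n ] upper g i j
    upper-< : ∀ {i j} → i < j → upper g i j ≡ g i j
    upper-< {i} {j} i<j = cong (if_then g i j else 0) (dec-true (i <? j) i<j)
    upper-≮ : ∀ {i j} → ¬ i < j → upper g i j ≡ 0
    upper-≮ {i} {j} i≮j = cong (if_then g i j else 0) (dec-false (i <? j) i≮j)
    split : ∀ i j → g i j ≡ upper g i j + upper g j i
    split i j with <-cmp i j
    ... | tri< i<j _ j≮i = sym (trans (cong₂ _+_ (upper-< i<j) (upper-≮ j≮i)) (ℕₚ.+-identityʳ (g i j)))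
    ... | tri≈ i≮i refl _ = trans (g-diag i) (sym (cong₂ _+_ (upper-≮ i≮i) (upper-≮ i≮i)))
    ... | tri> i≮j _ j<i = trans (g-sym i j) (sym (cong₂ _+_ (upper-≮ i≮j) (upper-< j<i)))

  sumFin²≡∑∑ : ∀ n (g : Fin n → Fin n → ℕ) →
               sumFin n (λ i → sumFin n (g i)) ≡ ∑[ i < n ] ∑[ j < n ] g i j
  sumFin²≡∑∑ n g = trans (sumFin≡sum n _) (sum-cong-≗ (λ i → sumFin≡sum n (g i)))

  ∑∑-upper≡half : ∀ {n} (g : Fin n → Fin n → ℕ) → (∀ i j → g i j ≡ g j i) → (∀ i → g i i ≡ 0) →
                  ∑[ i < n ] ∑[ j < n ] upper g i j ≡ (∑[ i < n ] ∑[ j < n ] g i j) / 2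
  ∑∑-upper≡half {n} g g-sym g-diag = trans (sym (m*n/n≡m S 2))
    (cong (_/ 2) (trans (ℕₚ.*-comm S 2) (∑∑-upper g g-sym g-diag)))
    where
    S = ∑[ i < n ] ∑[ j < n ] upper g i j

open FiniteSums

open import Data.Integer using (ℤ; +_; -[1+_]; -_; _+_; _-_; _*_; ∣_∣; 0ℤ; 1ℤ)
import Data.Integer.Properties as ℤₚ
open import Data.Integer.Divisibility.Signed
  using (_∣_; divides; _∣?_; ∣ᵤ⇒∣; ∣⇒∣ᵤ; ∣m∣n⇒∣m+n; ∣m∣n⇒∣m-n; ∣m+n∣m⇒∣n; ∣m+n∣n⇒∣m; ∣n⇒∣m*n; ∣m⇒∣m*n; ∣m⇒∣-m)
open import Data.Integer.DivMod using (_%ℕ_; _/ℕ_; n%ℕd<d; a≡a%ℕn+[a/ℕn]*n)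
open import Data.Integer.Tactic.RingSolver using (solve-∀)

ℤ² : Set
ℤ² = ℤ × ℤ

det-self : ∀ v → det v v ≡ 0ℤ
det-self (v₁ , v₂) = expand v₁ v₂
  where
  expand : ∀ v₁ v₂ → v₁ * v₂ - v₂ * v₁ ≡ 0ℤ
  expand = solve-∀

linComb : ℤ → ℤ² → ℤ → ℤ² → ℤ²
linComb α (u₁ , u₂) β (v₁ , v₂) = (α * u₁ + β * v₁ , α * u₂ + β * v₂)

det-linCombʳ : ∀ z α u β v → det z (linComb α u β v) ≡ α * det z u + β * det z v
det-linCombʳ (z₁ , z₂) α (u₁ , u₂) β (v₁ , v₂) = expand z₁ z₂ α u₁ u₂ β v₁ v₂
  where
  expand : ∀ z₁ z₂ α u₁ u₂ β v₁ v₂ →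
           z₁ * (α * u₂ + β * v₂) - z₂ * (α * u₁ + β * v₁)
             ≡ α * (z₁ * u₂ - z₂ * u₁) + β * (z₁ * v₂ - z₂ * v₁)
  expand = solve-∀

det-linCombˡ : ∀ z α u β v → det (linComb α u β v) z ≡ α * det u z + β * det v z
det-linCombˡ (z₁ , z₂) α (u₁ , u₂) β (v₁ , v₂) = expand z₁ z₂ α u₁ u₂ β v₁ v₂
  where
  expand : ∀ z₁ z₂ α u₁ u₂ β v₁ v₂ →
           (α * u₁ + β * v₁) * z₂ - (α * u₂ + β * v₂) * z₁
             ≡ α * (u₁ * z₂ - u₂ * z₁) + β * (v₁ * z₂ - v₂ * z₁)
  expand = solve-∀

det-linComb-self : ∀ α u β v → det (linComb α u β v) v ≡ α * det u v
det-linComb-self α (u₁ , u₂) β (v₁ , v₂) = expand α u₁ u₂ β v₁ v₂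
  where
  expand : ∀ α u₁ u₂ β v₁ v₂ → (α * u₁ + β * v₁) * v₂ - (α * u₂ + β * v₂) * v₁ ≡ α * (u₁ * v₂ - u₂ * v₁)
  expand = solve-∀

det-linComb-∓ : ∀ α u τ v → det (linComb α u (- τ) v) (linComb α u τ v) ≡ + 2 * α * τ * det u v
det-linComb-∓ α (u₁ , u₂) τ (v₁ , v₂) = expand α u₁ u₂ τ v₁ v₂
  where
  expand : ∀ α u₁ u₂ τ v₁ v₂ →
           (α * u₁ + - τ * v₁) * (α * u₂ + τ * v₂) - (α * u₂ + - τ * v₂) * (α * u₁ + τ * v₁)
             ≡ + 2 * α * τ * (u₁ * v₂ - u₂ * v₁)
  expand = solve-∀

-- Up to the factor det a b / 2, this is the Jacobian of the binary quadratic forms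
-- x ↦ det x a · det x b and x ↦ det x r · det x s; its zeros are the pair of points
-- harmonic with respect to both {a, b} and {r, s}.
jacobian : ℤ² → ℤ² → ℤ² → ℤ² → ℤ² → ℤ
jacobian a b r s c = det r a * det s a * (det c b * det c b) - det r b * det s b * (det c a * det c a)

polar-conjugate≡jacobian : ∀ a b r s c →
  det a b * det (linComb (det r c) s (det s c) r) (linComb (det c a) b (det c b) a)
    ≡ + 2 * jacobian a b r s c
polar-conjugate≡jacobian (a₁ , a₂) (b₁ , b₂) (r₁ , r₂) (s₁ , s₂) (c₁ , c₂) =
  expand a₁ a₂ b₁ b₂ r₁ r₂ s₁ s₂ c₁ c₂
  where
  expand : ∀ a₁ a₂ b₁ b₂ r₁ r₂ s₁ s₂ c₁ c₂ →
    let det = λ x₁ x₂ y₁ y₂ → x₁ * y₂ - x₂ * y₁ in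
    det a₁ a₂ b₁ b₂ *
      det (det r₁ r₂ c₁ c₂ * s₁ + det s₁ s₂ c₁ c₂ * r₁) (det r₁ r₂ c₁ c₂ * s₂ + det s₁ s₂ c₁ c₂ * r₂)
          (det c₁ c₂ a₁ a₂ * b₁ + det c₁ c₂ b₁ b₂ * a₁) (det c₁ c₂ a₁ a₂ * b₂ + det c₁ c₂ b₁ b₂ * a₂)
      ≡ + 2 * (det r₁ r₂ a₁ a₂ * det s₁ s₂ a₁ a₂ * (det c₁ c₂ b₁ b₂ * det c₁ c₂ b₁ b₂)
               - det r₁ r₂ b₁ b₂ * det s₁ s₂ b₁ b₂ * (det c₁ c₂ a₁ a₂ * det c₁ c₂ a₁ a₂))
  expand = solve-∀

jacobian-swap : ∀ a b r s c → jacobian a b s r c ≡ jacobian a b r s c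
jacobian-swap a b r s c = expand (det r a) (det s a) (det r b) (det s b) (det c a) (det c b)
  where
  expand : ∀ ra sa rb sb ca cb → sa * ra * (cb * cb) - sb * rb * (ca * ca) ≡ ra * sa * (cb * cb) - rb * sb * (ca * ca)
  expand = solve-∀

jacobian-diagonal : ∀ a b c → jacobian a b a b c ≡ 0ℤ
jacobian-diagonal (a₁ , a₂) (b₁ , b₂) (c₁ , c₂) = expand a₁ a₂ b₁ b₂ c₁ c₂
  where
  expand : ∀ a₁ a₂ b₁ b₂ c₁ c₂ →
    let det = λ x₁ x₂ y₁ y₂ → x₁ * y₂ - x₂ * y₁ in
    det a₁ a₂ a₁ a₂ * det b₁ b₂ a₁ a₂ * (det c₁ c₂ b₁ b₂ * det c₁ c₂ b₁ b₂)
      - det a₁ a₂ b₁ b₂ * det b₁ b₂ b₁ b₂ * (det c₁ c₂ a₁ a₂ * det c₁ c₂ a₁ a₂) ≡ 0ℤ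
  expand = solve-∀

jacobian-at-first : ∀ a b r s → jacobian a b r s a ≡ det r a * det s a * (det a b * det a b)
jacobian-at-first (a₁ , a₂) (b₁ , b₂) (r₁ , r₂) (s₁ , s₂) = expand a₁ a₂ b₁ b₂ r₁ r₂ s₁ s₂
  where
  expand : ∀ a₁ a₂ b₁ b₂ r₁ r₂ s₁ s₂ →
    let det = λ x₁ x₂ y₁ y₂ → x₁ * y₂ - x₂ * y₁ in
    det r₁ r₂ a₁ a₂ * det s₁ s₂ a₁ a₂ * (det a₁ a₂ b₁ b₂ * det a₁ a₂ b₁ b₂)
      - det r₁ r₂ b₁ b₂ * det s₁ s₂ b₁ b₂ * (det a₁ a₂ a₁ a₂ * det a₁ a₂ a₁ a₂)
      ≡ det r₁ r₂ a₁ a₂ * det s₁ s₂ a₁ a₂ * (det a₁ a₂ b₁ b₂ * det a₁ a₂ b₁ b₂)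
  expand = solve-∀

jacobian-at-second : ∀ a b r s → - jacobian a b r s b ≡ det r b * det s b * (det b a * det b a)
jacobian-at-second (a₁ , a₂) (b₁ , b₂) (r₁ , r₂) (s₁ , s₂) = expand a₁ a₂ b₁ b₂ r₁ r₂ s₁ s₂
  where
  expand : ∀ a₁ a₂ b₁ b₂ r₁ r₂ s₁ s₂ →
    let det = λ x₁ x₂ y₁ y₂ → x₁ * y₂ - x₂ * y₁ in
    - (det r₁ r₂ a₁ a₂ * det s₁ s₂ a₁ a₂ * (det b₁ b₂ b₁ b₂ * det b₁ b₂ b₁ b₂)
       - det r₁ r₂ b₁ b₂ * det s₁ s₂ b₁ b₂ * (det b₁ b₂ a₁ a₂ * det b₁ b₂ a₁ a₂))
      ≡ det r₁ r₂ b₁ b₂ * det s₁ s₂ b₁ b₂ * (det b₁ b₂ a₁ a₂ * det b₁ b₂ a₁ a₂)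
  expand = solve-∀

jacobian-factor : ∀ a b r s c t →
  let α = det r a ; β = det r b ; γ = det s a ; δ = det s b in
  γ * (det c (linComb α b (- (t * β)) a) * det c (linComb α b (t * β) a)) - α * jacobian a b r s c
    ≡ - (β * (det c a * det c a)) * (t * t * (β * γ) - α * δ)
jacobian-factor a b r s c t =
  trans (cong (λ k → γ * k - α * jacobian a b r s c)
              (cong₂ _*_ (det-linCombʳ c α b (- (t * β)) a) (det-linCombʳ c α b (t * β) a)))
        (expand α β γ δ (det c a) (det c b) t)
  where
  α = det r a
  β = det r b
  γ = det s a
  δ = det s b
  expand : ∀ α β γ δ P Q t →
           γ * ((α * Q + - (t * β) * P) * (α * Q + t * β * P)) - α * (α * γ * (Q * Q) - β * δ * (P * P))
             ≡ - (β * (P * P)) * (t * t * (β * γ) - α * δ)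
  expand = solve-∀

odd-prime∤2 : ∀ {q} → Prime q → q % 2 ≡ 1 → ¬ q ℕᵈ.∣ 2
odd-prime∤2 {0} q-prime _ _ = ¬prime[0] q-prime
odd-prime∤2 {1} q-prime _ _ = ¬prime[1] q-prime
odd-prime∤2 {2} _ () _
odd-prime∤2 {suc (suc (suc q))} _ _ q∣2 with ℕᵈ.∣⇒≤ q∣2
... | s≤s (s≤s ())

module PrimeField (p : ℕ) (p-prime : Prime p) where

  instance
    p-nonZero : ℕ.NonZero p
    p-nonZero = prime⇒nonZero p-prime

  infix 4 _≈0
  _≈0 : ℤ → Set
  x ≈0 = + p ∣ x

  0≈0 : 0ℤ ≈0
  0≈0 = divides 0ℤ refl

  1≉0 : ¬ 1ℤ ≈0
  1≉0 p∣1 = ¬prime[1] (subst Prime (ℕᵈ.∣1⇒≡1 (∣⇒∣ᵤ p∣1)) p-prime)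

  ≈0-split : ∀ x y → x * y ≈0 → x ≈0 ⊎ y ≈0
  ≈0-split x y xy≈0 =
    Sum.map ∣ᵤ⇒∣ ∣ᵤ⇒∣ (euclidsLemma ∣ x ∣ ∣ y ∣ p-prime (subst (p ℕᵈ.∣_) (ℤₚ.abs-* x y) (∣⇒∣ᵤ xy≈0)))

  ≉0-* : ∀ {x y} → ¬ x ≈0 → ¬ y ≈0 → ¬ x * y ≈0
  ≉0-* {x} {y} x≉0 y≉0 = Sum.[ x≉0 , y≉0 ] ∘ ≈0-split x y

  ≈0-*-⇔ : ∀ {μ x} → ¬ μ ≈0 → μ * x ≈0 ⇔ x ≈0
  ≈0-*-⇔ {μ} {x} μ≉0 = mk⇔ (Sum.[ flip contradiction μ≉0 , id ] ∘ ≈0-split μ x) (∣n⇒∣m*n μ)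

  ≈0-split₃ : ∀ x y z → x * y * (z * z) ≈0 → x ≈0 ⊎ y ≈0 ⊎ z ≈0
  ≈0-split₃ x y z xyzz≈0 with ≈0-split (x * y) (z * z) xyzz≈0
  ... | inj₁ xy≈0 = Sum.map₂ inj₁ (≈0-split x y xy≈0)
  ... | inj₂ zz≈0 = inj₂ (inj₂ (Sum.reduce (≈0-split z z zz≈0)))

  ≈0-diff-⇔ : ∀ {x y} → x - y ≈0 → x ≈0 ⇔ y ≈0
  ≈0-diff-⇔ {x} {y} x-y≈0 =
    mk⇔ (λ x≈0 → subst _≈0 (expand₁ x y) (∣m∣n⇒∣m-n x≈0 x-y≈0))
        (λ y≈0 → subst _≈0 (expand₂ x y) (∣m∣n⇒∣m+n x-y≈0 y≈0))
    where
    expand₁ : ∀ x y → x - (x - y) ≡ y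
    expand₁ = solve-∀
    expand₂ : ∀ x y → (x - y) + y ≡ x
    expand₂ = solve-∀

  ≈0-small : ∀ {x} → ∣ x ∣ ℕ.< p → x ≈0 → x ≡ 0ℤ
  ≈0-small {x} ∣x∣<p x≈0 with ∣ x ∣ in ∣x∣≡
  ... | zero  = ℤₚ.∣i∣≡0⇒i≡0 ∣x∣≡
  ... | suc _ = contradiction (subst (p ℕᵈ.∣_) ∣x∣≡ (∣⇒∣ᵤ x≈0)) (ℕᵈ.>⇒∤ ∣x∣<p)

  residue-injective : ∀ {i j} → i ℕ.< p → j ℕ.< p → + i - + j ≈0 → i ≡ j
  residue-injective {i} {j} i<p j<p i-j≈0 =
    ℤₚ.+-injective (ℤₚ.i-j≡0⇒i≡j (+ i) (+ j) (≈0-small ∣i-j∣<p i-j≈0))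
    where
    ∣i-j∣<p : ∣ + i - + j ∣ ℕ.< p
    ∣i-j∣<p = subst (ℕ._< p) (sym (cong ∣_∣ (ℤₚ.[+m]-[+n]≡m⊖n i j)))
                (ℕₚ.≤-<-trans (ℤₚ.∣m⊝n∣≤m⊔n i j) (ℕₚ.⊔-lub i<p j<p))

  coprime-of-∤ : ∀ {n} → ¬ p ℕᵈ.∣ n → Coprime n p
  coprime-of-∤ p∤n (d∣n , d∣p) with prime⇒irreducible p-prime d∣p
  ... | inj₁ d≡1 = d≡1
  ... | inj₂ refl = contradiction d∣n p∤n

  inverse-of-ℕ : ∀ n → ¬ p ℕᵈ.∣ n → ∃[ y ] + n * y - 1ℤ ≈0
  inverse-of-ℕ n p∤n with coprime-Bézout (coprime-of-∤ p∤n)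
  ... | Bézout.+- x y eq = + x , divides (+ y) (begin
    + n * + x - 1ℤ         ≡⟨ cong (_- 1ℤ) (trans (ℤₚ.*-comm (+ n) (+ x)) (sym (ℤₚ.pos-* x n))) ⟩
    + (x ℕ.* n) - 1ℤ       ≡⟨ cong (λ k → + k - 1ℤ) eq ⟨
    1ℤ + + (y ℕ.* p) - 1ℤ  ≡⟨ expand (+ (y ℕ.* p)) ⟩
    + (y ℕ.* p)            ≡⟨ ℤₚ.pos-* y p ⟩
    + y * + p              ∎)
    where
    open ≡-Reasoning
    expand : ∀ k → 1ℤ + k - 1ℤ ≡ k
    expand = solve-∀
  ... | Bézout.-+ x y eq = - + x , divides (- + y) (begin
    + n * - + x - 1ℤ         ≡⟨ expand (+ n) (+ x) ⟩
    - (1ℤ + + x * + n)       ≡⟨ cong (λ k → - (1ℤ + k)) (sym (ℤₚ.pos-* x n)) ⟩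
    - + (1 ℕ.+ x ℕ.* n)      ≡⟨ cong (λ k → - + k) eq ⟩
    - + (y ℕ.* p)            ≡⟨ cong -_ (ℤₚ.pos-* y p) ⟩
    - (+ y * + p)            ≡⟨ ℤₚ.neg-distribˡ-* (+ y) (+ p) ⟩
    - + y * + p              ∎)
    where
    open ≡-Reasoning
    expand : ∀ n x → n * - x - 1ℤ ≡ - (1ℤ + x * n)
    expand = solve-∀

  inverse : ∀ {x} → ¬ x ≈0 → ∃[ y ] x * y - 1ℤ ≈0
  inverse {+ n} x≉0 = inverse-of-ℕ n (x≉0 ∘ ∣ᵤ⇒∣)
  inverse { -[1+ n ]} x≉0 with inverse-of-ℕ (suc n) (x≉0 ∘ ∣ᵤ⇒∣)
  ... | y , ny-1≈0 = - y , subst _≈0 (cong (_- 1ℤ) (expand (+ suc n) y)) ny-1≈0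
    where
    expand : ∀ n y → n * y ≡ - n * - y
    expand = solve-∀

module ProjectiveLine (p : ℕ) (p-prime : Prime p) where

  open PrimeField p p-prime

  Δ : Pearl p → Pearl p → ℤ
  Δ X Y = det (coord X) (coord Y)

  Δ-≈0⇒≡ : ∀ X Y → Δ X Y ≈0 → X ≡ Y
  Δ-≈0⇒≡ zero    zero    _   = refl
  Δ-≈0⇒≡ zero    (suc _) Δ≈0 = contradiction Δ≈0 1≉0
  Δ-≈0⇒≡ (suc i) zero    Δ≈0 = contradiction (subst _≈0 (expand (+ toℕ i)) (∣m⇒∣-m Δ≈0)) 1≉0
    where
    expand : ∀ i → - (i * 0ℤ - 1ℤ * 1ℤ) ≡ 1ℤ
    expand = solve-∀
  Δ-≈0⇒≡ (suc i) (suc j) Δ≈0 =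
    cong suc (toℕ-injective (residue-injective (toℕ<n i) (toℕ<n j) (subst _≈0 (expand (+ toℕ i) (+ toℕ j)) Δ≈0)))
    where
    expand : ∀ i j → i * 1ℤ - 1ℤ * j ≡ i - j
    expand = solve-∀

  ≡⇒Δ-≈0 : ∀ {X Y} → X ≡ Y → Δ X Y ≈0
  ≡⇒Δ-≈0 {X} refl = subst _≈0 (sym (det-self (coord X))) 0≈0

  ≢⇒Δ-≉0 : ∀ {X Y} → X ≢ Y → ¬ Δ X Y ≈0
  ≢⇒Δ-≉0 {X} {Y} X≢Y = X≢Y ∘ Δ-≈0⇒≡ X Y

  Δ*Δ-≈0⇒ : ∀ X Y Z W → Δ X Y * Δ Z W ≈0 → X ≡ Y ⊎ Z ≡ W
  Δ*Δ-≈0⇒ X Y Z W = Sum.map (Δ-≈0⇒≡ X Y) (Δ-≈0⇒≡ Z W) ∘ ≈0-split (Δ X Y) (Δ Z W)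

  -- For a vector not ≈ 0 this is proportionality modulo p.
  infix 4 _∥_
  _∥_ : ℤ² → ℤ² → Set
  u ∥ v = ∀ z → det z u ≈0 ⇔ det z v ≈0

  ∥-scale : ∀ {w d μ} → ¬ μ ≈0 → proj₁ w - μ * proj₁ d ≈0 → proj₂ w - μ * proj₂ d ≈0 → w ∥ d
  ∥-scale {w₁ , w₂} {d₁ , d₂} {μ} μ≉0 e₁ e₂ (z₁ , z₂) =
    ⇔-trans (≈0-diff-⇔ (subst _≈0 (expand z₁ z₂ w₁ w₂ d₁ d₂ μ) (∣m∣n⇒∣m-n (∣n⇒∣m*n z₁ e₂) (∣n⇒∣m*n z₂ e₁))))
            (≈0-*-⇔ μ≉0)
    where
    expand : ∀ z₁ z₂ w₁ w₂ d₁ d₂ μ →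
             z₁ * (w₂ - μ * d₂) - z₂ * (w₁ - μ * d₁) ≡ (z₁ * w₂ - z₂ * w₁) - μ * (z₁ * d₂ - z₂ * d₁)
    expand = solve-∀

  pearlOf : ∀ w z → ¬ det w z ≈0 → Σ[ D ∈ Pearl p ] w ∥ coord D
  pearlOf (w₁ , w₂) (z₁ , z₂) wz≉0 with + p ∣? w₂
  ... | yes w₂≈0 = zero , ∥-scale w₁≉0 (subst _≈0 (sym (expand₁ w₁)) 0≈0) (subst _≈0 (sym (expand₂ w₁ w₂)) w₂≈0)
    where
    w₁≉0 : ¬ w₁ ≈0
    w₁≉0 w₁≈0 = wz≉0 (∣m∣n⇒∣m-n (∣m⇒∣m*n z₂ w₁≈0) (∣m⇒∣m*n z₁ w₂≈0))
    expand₁ : ∀ w₁ → w₁ - w₁ * 1ℤ ≡ 0ℤ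
    expand₁ = solve-∀
    expand₂ : ∀ w₁ w₂ → w₂ - w₁ * 0ℤ ≡ w₂
    expand₂ = solve-∀
  ... | no w₂≉0 = suc (fromℕ< r<p) , ∥-scale w₂≉0 w₁-w₂r≈0 (subst _≈0 (sym (expand₁ w₂)) 0≈0)
    where
    expand₁ : ∀ w₂ → w₂ - w₂ * 1ℤ ≡ 0ℤ
    expand₁ = solve-∀
    expand₂ : ∀ r k → r + k - r ≡ k
    expand₂ = solve-∀
    expand₃ : ∀ w₁ w₂ y r → w₂ * (w₁ * y - r) - w₁ * (w₂ * y - 1ℤ) ≡ w₁ - w₂ * r
    expand₃ = solve-∀
    y = proj₁ (inverse w₂≉0)
    r = (w₁ * y) %ℕ p
    r<p = n%ℕd<d (w₁ * y) p
    w₁y-r≈0 : w₁ * y - + r ≈0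
    w₁y-r≈0 = divides ((w₁ * y) /ℕ p)
      (trans (cong (_- + r) (a≡a%ℕn+[a/ℕn]*n (w₁ * y) p)) (expand₂ (+ r) ((w₁ * y) /ℕ p * + p)))
    w₁-w₂r≈0 : w₁ - w₂ * + toℕ (fromℕ< r<p) ≈0
    w₁-w₂r≈0 = subst _≈0 (trans (expand₃ w₁ w₂ y (+ r)) (cong (λ k → w₁ - w₂ * + k) (sym (toℕ-fromℕ< r<p))))
                 (∣m∣n⇒∣m-n (∣n⇒∣m*n w₂ w₁y-r≈0) (∣n⇒∣m*n w₁ (proj₂ (inverse w₂≉0))))

  ∥-pearl : ∀ {w} {D : Pearl p} → w ∥ coord D → ∀ X → det (coord X) w ≈0 ⇔ X ≡ D
  ∥-pearl {w} {D} w∥D X = mk⇔ (Δ-≈0⇒≡ X D ∘ to (w∥D (coord X))) (from (w∥D (coord X)) ∘ ≡⇒Δ-≈0)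

  ∥-distinct : ∀ {u v} {U V : Pearl p} → u ∥ coord U → v ∥ coord V → ¬ det u v ≈0 → U ≢ V
  ∥-distinct {u} {v} u∥U v∥V uv≉0 refl =
    uv≉0 (from (v∥V u) (to (u∥U u) (subst _≈0 (sym (det-self u)) 0≈0)))

module HarmonicPairs (p : ℕ) (p-prime : Prime p) (p-odd : p % 2 ≡ 1) where

  open PrimeField p p-prime
  open ProjectiveLine p p-prime

  2≉0 : ¬ + 2 ≈0
  2≉0 = odd-prime∤2 p-prime p-odd ∘ ∣⇒∣ᵤ

  crossSum : (X Y W T : Pearl p) → ℤ
  crossSum X Y W T = crNum X Y W T + crDen X Y W T

  crossSum-swapˡ : ∀ X Y W T → crossSum Y X W T ≡ crossSum X Y W T
  crossSum-swapˡ X Y W T = ℤₚ.+-comm (crNum Y X W T) (crDen Y X W T)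

  crossSum-swapʳ : ∀ X Y W T → crossSum X Y T W ≡ crossSum X Y W T
  crossSum-swapʳ X Y W T = expand (Δ W X) (Δ T Y) (Δ W Y) (Δ T X)
    where
    expand : ∀ wx ty wy tx → tx * wy + ty * wx ≡ wx * ty + wy * tx
    expand = solve-∀

  Harmonic : (X Y W T : Pearl p) → Set
  Harmonic X Y W T = X ≢ Y × W ≢ T × crossSum X Y W T ≈0

  harmonic? : ∀ X Y W T → Dec (Harmonic X Y W T)
  harmonic? X Y W T = ¬? (X ≟ Y) ×-dec ¬? (W ≟ T) ×-dec + p ∣? crossSum X Y W T

  harmonic-swapˡ : ∀ {X Y W T} → Harmonic X Y W T → Harmonic Y X W T
  harmonic-swapˡ {X} {Y} {W} {T} (X≢Y , W≢T , sum≈0) =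
    X≢Y ∘ sym , W≢T , subst _≈0 (sym (crossSum-swapˡ X Y W T)) sum≈0

  harmonic-swapʳ : ∀ {X Y W T} → Harmonic X Y W T → Harmonic X Y T W
  harmonic-swapʳ {X} {Y} {W} {T} (X≢Y , W≢T , sum≈0) =
    X≢Y , W≢T ∘ sym , subst _≈0 (sym (crossSum-swapʳ X Y W T)) sum≈0

  harmonic⇒≢ : ∀ {X Y W T} → Harmonic X Y W T → W ≢ X
  harmonic⇒≢ {X} {Y} {W} {T} (X≢Y , W≢T , sum≈0) refl =
    Sum.[ X≢Y , W≢T ∘ sym ] (Δ*Δ-≈0⇒ X Y T X (∣m+n∣m⇒∣n sum≈0 (∣m⇒∣m*n (Δ T Y) (≡⇒Δ-≈0 {X} refl))))

  CrossRatio≡-1 : (X Y W T : Pearl p) → Set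
  CrossRatio≡-1 X Y W T = (X ≢ Y × X ≢ W × Y ≢ W) × ¬ crDen X Y W T ≈0 × crossSum X Y W T ≈0

  -- Its `does` is literally `harmonic p X Y W T`, so `alphaCoeff p X Y W T` is 𝟙 of it by definition.
  crossRatio≡-1? : ∀ X Y W T → Dec (CrossRatio≡-1 X Y W T)
  crossRatio≡-1? X Y W T =
    (¬? (X ≟ Y) ×-dec ¬? (X ≟ W) ×-dec ¬? (Y ≟ W)) ×-dec ¬? (+ p ∣? crDen X Y W T) ×-dec + p ∣? crossSum X Y W T

  crossRatio≡-1⇔harmonic : ∀ X Y W T → CrossRatio≡-1 X Y W T ⇔ Harmonic X Y W T
  crossRatio≡-1⇔harmonic X Y W T = mk⇔
    (λ ((X≢Y , _ , _) , den≉0 , sum≈0) → X≢Y , W≢T den≉0 sum≈0 , sum≈0)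
    (λ h@(X≢Y , W≢T , sum≈0) →
      (X≢Y , harmonic⇒≢ h ∘ sym , harmonic⇒≢ (harmonic-swapˡ h) ∘ sym) , den≉0 X≢Y W≢T sum≈0 , sum≈0)
    where
    W≢T : ¬ crDen X Y W T ≈0 → crossSum X Y W T ≈0 → W ≢ T
    W≢T den≉0 sum≈0 refl = den≉0 (to (≈0-*-⇔ 2≉0) (subst _≈0 (expand (Δ W X) (Δ W Y)) sum≈0))
      where
      expand : ∀ wx wy → wx * wy + wy * wx ≡ + 2 * (wy * wx)
      expand = solve-∀
    den≉0 : X ≢ Y → W ≢ T → crossSum X Y W T ≈0 → ¬ crDen X Y W T ≈0
    den≉0 X≢Y W≢T sum≈0 den≈0
      with Δ*Δ-≈0⇒ W Y T X den≈0 | Δ*Δ-≈0⇒ W X T Y (∣m+n∣n⇒∣m sum≈0 den≈0)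
    ... | inj₁ refl | inj₁ refl = X≢Y refl
    ... | inj₁ refl | inj₂ refl = W≢T refl
    ... | inj₂ refl | inj₁ refl = W≢T refl
    ... | inj₂ refl | inj₂ refl = X≢Y refl

  alphaCoeff≡𝟙 : ∀ X Y W T → alphaCoeff p X Y W T ≡ 𝟙 (harmonic? X Y W T)
  alphaCoeff≡𝟙 X Y W T = 𝟙-cong (crossRatio≡-1? X Y W T) (harmonic? X Y W T) (crossRatio≡-1⇔harmonic X Y W T)

  alphaCoeff-resp : ∀ {X Y W T X′ Y′ W′ T′} → Harmonic X Y W T ⇔ Harmonic X′ Y′ W′ T′ →
                    alphaCoeff p X Y W T ≡ alphaCoeff p X′ Y′ W′ T′
  alphaCoeff-resp {X} {Y} {W} {T} {X′} {Y′} {W′} {T′} h⇔h′ =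
    trans (alphaCoeff≡𝟙 X Y W T)
          (trans (𝟙-cong (harmonic? X Y W T) (harmonic? X′ Y′ W′ T′) h⇔h′) (sym (alphaCoeff≡𝟙 X′ Y′ W′ T′)))

  jac : (A B R S C : Pearl p) → ℤ
  jac A B R S C = jacobian (coord A) (coord B) (coord R) (coord S) (coord C)

  module Conjugate {A B C : Pearl p} (A≢B : A ≢ B) (C≢A : C ≢ A) (C≢B : C ≢ B) where

    w : ℤ²
    w = linComb (Δ C A) (coord B) (Δ C B) (coord A)

    conjugate : Σ[ D ∈ Pearl p ] w ∥ coord D
    conjugate = pearlOf w (coord A) (≉0-* (≢⇒Δ-≉0 C≢A) (≢⇒Δ-≉0 (A≢B ∘ sym)) ∘ subst _≈0 wA≡)
      where
      wA≡ : det w (coord A) ≡ Δ C A * Δ B A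
      wA≡ = det-linComb-self (Δ C A) (coord B) (Δ C B) (coord A)

    conj : Pearl p
    conj = proj₁ conjugate

    w∥conj : w ∥ coord conj
    w∥conj = proj₂ conjugate

    C≢conj : C ≢ conj
    C≢conj = ≉0-* 2≉0 (≉0-* (≢⇒Δ-≉0 C≢A) (≢⇒Δ-≉0 C≢B)) ∘ subst _≈0 Cw≡ ∘ from (∥-pearl w∥conj C)
      where
      Cw≡ : det (coord C) w ≡ + 2 * (Δ C A * Δ C B)
      Cw≡ = trans (det-linCombʳ (coord C) (Δ C A) (coord B) (Δ C B) (coord A)) (expand (Δ C A) (Δ C B))
        where
        expand : ∀ ca cb → ca * cb + cb * ca ≡ + 2 * (ca * cb)
        expand = solve-∀

    harmonic⇔conj : ∀ D → Harmonic A B C D ⇔ D ≡ conj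
    harmonic⇔conj D = mk⇔
      (λ (_ , _ , sum≈0) → to (∥-pearl w∥conj D) (subst _≈0 sum≡ sum≈0))
      (λ D≡conj → A≢B , (λ C≡D → C≢conj (trans C≡D D≡conj))
                  , subst _≈0 (sym sum≡) (from (∥-pearl w∥conj D) D≡conj))
      where
      sum≡ : crossSum A B C D ≡ det (coord D) w
      sum≡ = sym (det-linCombʳ (coord D) (Δ C A) (coord B) (Δ C B) (coord A))

    -- crossSum C D R S = det m (coord D) is linear in D, so it may be evaluated at w instead of
    -- at coord conj; there it equals 2 · jac / Δ A B.
    harmonic-conj⇔jac : ∀ {R S} → R ≢ S → Harmonic C conj R S ⇔ jac A B R S C ≈0
    harmonic-conj⇔jac {R} {S} R≢S = mk⇔
      (λ (_ , _ , sum≈0) → to (≈0-*-⇔ 2≉0) (subst _≈0 polar≡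
         (∣n⇒∣m*n (Δ A B) (from (w∥conj m) (subst _≈0 sum≡ sum≈0)))))
      (λ jac≈0 → C≢conj , R≢S , subst _≈0 (sym sum≡)
         (to (w∥conj m) (to (≈0-*-⇔ (≢⇒Δ-≉0 A≢B)) (subst _≈0 (sym polar≡) (∣n⇒∣m*n (+ 2) jac≈0)))))
      where
      m : ℤ²
      m = linComb (Δ R C) (coord S) (Δ S C) (coord R)
      sum≡ : crossSum C conj R S ≡ det m (coord conj)
      sum≡ = trans (cong (λ k → Δ R C * Δ S conj + k) (ℤₚ.*-comm (Δ R conj) (Δ S C)))
                   (sym (det-linCombˡ (coord conj) (Δ R C) (coord S) (Δ S C) (coord R)))
      polar≡ : Δ A B * det m w ≡ + 2 * jac A B R S C
      polar≡ = polar-conjugate≡jacobian (coord A) (coord B) (coord R) (coord S) (coord C)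

  Root : (A B R S C : Pearl p) → Set
  Root A B R S C = C ≢ A × C ≢ B × jac A B R S C ≈0

  root? : ∀ A B R S → Decidable (Root A B R S)
  root? A B R S C = ¬? (C ≟ A) ×-dec ¬? (C ≟ B) ×-dec + p ∣? jac A B R S C

  ∑-row : ∀ {A B R S} → A ≢ B → R ≢ S → ∀ C →
          ∑[ D < suc p ] (alphaCoeff p A B C D ℕ.* alphaCoeff p C D R S) ≡ 𝟙 (root? A B R S C)
  ∑-row {A} {B} {R} {S} A≢B R≢S C = by-cases (C ≟ A) (C ≟ B)
    where
    open ≡-Reasoning
    row : ℕ
    row = ∑[ D < suc p ] (alphaCoeff p A B C D ℕ.* alphaCoeff p C D R S)
    no-harmonic : (∀ D → ¬ Harmonic A B C D) → row ≡ 0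
    no-harmonic ¬h = ∑-zero (λ D → cong (ℕ._* alphaCoeff p C D R S)
                       (trans (alphaCoeff≡𝟙 A B C D) (𝟙-no (harmonic? A B C D) (¬h D))))
    by-cases : Dec (C ≡ A) → Dec (C ≡ B) → row ≡ 𝟙 (root? A B R S C)
    by-cases (yes C≡A) _ =
      trans (no-harmonic (λ D h → harmonic⇒≢ h C≡A)) (sym (𝟙-no (root? A B R S C) (λ (C≢A , _) → C≢A C≡A)))
    by-cases (no _) (yes C≡B) =
      trans (no-harmonic (λ D h → harmonic⇒≢ (harmonic-swapˡ h) C≡B))
            (sym (𝟙-no (root? A B R S C) (λ (_ , C≢B , _) → C≢B C≡B)))
    by-cases (no C≢A) (no C≢B) = begin
      row
        ≡⟨ sum-cong-≗ (λ D → cong (ℕ._* alphaCoeff p C D R S)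
             (trans (alphaCoeff≡𝟙 A B C D) (𝟙-cong (harmonic? A B C D) (D ≟ conj) (harmonic⇔conj D)))) ⟩
      ∑[ D < suc p ] (𝟙 (D ≟ conj) ℕ.* alphaCoeff p C D R S)
        ≡⟨ ∑-𝟙-≟-* conj (λ D → alphaCoeff p C D R S) ⟩
      alphaCoeff p C conj R S
        ≡⟨ alphaCoeff≡𝟙 C conj R S ⟩
      𝟙 (harmonic? C conj R S)
        ≡⟨ 𝟙-cong (harmonic? C conj R S) (root? A B R S C)
             (⇔-trans (harmonic-conj⇔jac R≢S) (mk⇔ (λ jac≈0 → C≢A , C≢B , jac≈0) (proj₂ ∘ proj₂))) ⟩
      𝟙 (root? A B R S C) ∎
      where
      open Conjugate A≢B C≢A C≢B

  alpha2Coeff≡half : ∀ {A B R S} → A ≢ B → R ≢ S →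
                     alpha2Coeff p A B R S ≡ (∑[ C < suc p ] 𝟙 (root? A B R S C)) / 2
  alpha2Coeff≡half {A} {B} {R} {S} A≢B R≢S = begin
    alpha2Coeff p A B R S                          ≡⟨ sumFin²≡∑∑ (suc p) (upper g) ⟩
    ∑[ C < suc p ] ∑[ D < suc p ] upper g C D      ≡⟨ ∑∑-upper≡half g g-sym g-diag ⟩
    (∑[ C < suc p ] ∑[ D < suc p ] g C D) / 2      ≡⟨ cong (_/ 2) (sum-cong-≗ (∑-row A≢B R≢S)) ⟩
    (∑[ C < suc p ] 𝟙 (root? A B R S C)) / 2       ∎
    where
    open ≡-Reasoning
    g : Pearl p → Pearl p → ℕ
    g C D = alphaCoeff p A B C D ℕ.* alphaCoeff p C D R S
    g-sym : ∀ C D → g C D ≡ g D C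
    g-sym C D = cong₂ ℕ._*_ (alphaCoeff-resp {A} {B} {C} {D} (mk⇔ harmonic-swapʳ harmonic-swapʳ))
                            (alphaCoeff-resp {C} {D} {R} {S} (mk⇔ harmonic-swapˡ harmonic-swapˡ))
    g-diag : ∀ C → g C C ≡ 0
    g-diag C = trans (cong (alphaCoeff p A B C C ℕ.*_) (trans (alphaCoeff≡𝟙 C C R S)
                 (𝟙-no (harmonic? C C R S) (λ (C≢C , _) → C≢C refl))))
                 (ℕₚ.*-zeroʳ (alphaCoeff p A B C C))

  ∑-root-diagonal : ∀ {A B} → A ≢ B → ∑[ C < suc p ] 𝟙 (root? A B A B C) ≡ p ∸ 1
  ∑-root-diagonal {A} {B} A≢B = ∑-𝟙-all-but-pair (root? A B A B) A≢B λ C → mk⇔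
    (λ (C≢A , C≢B , _) → C≢A , C≢B)
    (λ (C≢A , C≢B) → C≢A , C≢B , subst _≈0 (sym (jacobian-diagonal (coord A) (coord B) (coord C))) 0≈0)

  ∑-root-swap : ∀ {A B R S} → ∑[ C < suc p ] 𝟙 (root? A B R S C) ≡ ∑[ C < suc p ] 𝟙 (root? A B S R C)
  ∑-root-swap {A} {B} {R} {S} = sum-cong-≗ λ C → 𝟙-cong (root? A B R S C) (root? A B S R C) (mk⇔
    (λ (C≢A , C≢B , jac≈0) → C≢A , C≢B , subst _≈0 (sym (swap C)) jac≈0)
    (λ (C≢A , C≢B , jac≈0) → C≢A , C≢B , subst _≈0 (swap C) jac≈0))
    where
    swap : ∀ C → jac A B S R C ≡ jac A B R S C
    swap C = jacobian-swap (coord A) (coord B) (coord R) (coord S) (coord C)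

  module SquareRoots {A B R S : Pearl p} (A≢B : A ≢ B)
                     (num≉0 : ¬ Δ R A * Δ S B ≈0) (den≉0 : ¬ Δ R B * Δ S A ≈0)
                     (t : ℤ) (t-root : t * t * (Δ R B * Δ S A) - Δ R A * Δ S B ≈0) where

    RA≉0 : ¬ Δ R A ≈0
    RA≉0 = num≉0 ∘ ∣m⇒∣m*n (Δ S B)

    RB≉0 : ¬ Δ R B ≈0
    RB≉0 = den≉0 ∘ ∣m⇒∣m*n (Δ S A)

    SA≉0 : ¬ Δ S A ≈0
    SA≉0 = den≉0 ∘ ∣n⇒∣m*n (Δ R B)

    SB≉0 : ¬ Δ S B ≈0
    SB≉0 = num≉0 ∘ ∣n⇒∣m*n (Δ R A)

    t≉0 : ¬ t ≈0
    t≉0 = num≉0 ∘ to (≈0-diff-⇔ t-root) ∘ ∣m⇒∣m*n (Δ R B * Δ S A) ∘ ∣m⇒∣m*n t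

    AB≉0 : ¬ Δ A B ≈0
    AB≉0 = ≢⇒Δ-≉0 A≢B

    BA≉0 : ¬ Δ B A ≈0
    BA≉0 = ≢⇒Δ-≉0 (A≢B ∘ sym)

    τ : ℤ
    τ = t * Δ R B

    u v : ℤ²
    u = linComb (Δ R A) (coord B) (- τ) (coord A)
    v = linComb (Δ R A) (coord B) τ (coord A)

    root-u : Σ[ U ∈ Pearl p ] u ∥ coord U
    root-u = pearlOf u (coord A) (≉0-* RA≉0 BA≉0 ∘ subst _≈0 (det-linComb-self (Δ R A) (coord B) (- τ) (coord A)))

    root-v : Σ[ V ∈ Pearl p ] v ∥ coord V
    root-v = pearlOf v (coord A) (≉0-* RA≉0 BA≉0 ∘ subst _≈0 (det-linComb-self (Δ R A) (coord B) τ (coord A)))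

    U V : Pearl p
    U = proj₁ root-u
    V = proj₁ root-v

    u∥U : u ∥ coord U
    u∥U = proj₂ root-u

    v∥V : v ∥ coord V
    v∥V = proj₂ root-v

    U≢V : U ≢ V
    U≢V = ∥-distinct u∥U v∥V
      (≉0-* (≉0-* (≉0-* 2≉0 RA≉0) (≉0-* t≉0 RB≉0)) BA≉0 ∘ subst _≈0 (det-linComb-∓ (Δ R A) (coord B) τ (coord A)))

    jac⇔uv : ∀ C → jac A B R S C ≈0 ⇔ det (coord C) u * det (coord C) v ≈0
    jac⇔uv C = ⇔-trans (⇔-sym (≈0-*-⇔ RA≉0)) (⇔-trans (⇔-sym (≈0-diff-⇔ factor)) (≈0-*-⇔ SA≉0))
      where
      factor : Δ S A * (det (coord C) u * det (coord C) v) - Δ R A * jac A B R S C ≈0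
      factor = subst _≈0 (sym (jacobian-factor (coord A) (coord B) (coord R) (coord S) (coord C) t))
                 (∣n⇒∣m*n (- (Δ R B * (Δ C A * Δ C A))) t-root)

    jac-at-A≉0 : ¬ jac A B R S A ≈0
    jac-at-A≉0 = ≉0-* (≉0-* RA≉0 SA≉0) (≉0-* AB≉0 AB≉0)
               ∘ subst _≈0 (jacobian-at-first (coord A) (coord B) (coord R) (coord S))

    jac-at-B≉0 : ¬ jac A B R S B ≈0
    jac-at-B≉0 = ≉0-* (≉0-* RB≉0 SB≉0) (≉0-* BA≉0 BA≉0)
               ∘ subst _≈0 (jacobian-at-second (coord A) (coord B) (coord R) (coord S)) ∘ ∣m⇒∣-m

    uv≈0⇔U-or-V : ∀ C → det (coord C) u * det (coord C) v ≈0 ⇔ (C ≡ U ⊎ C ≡ V)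
    uv≈0⇔U-or-V C = mk⇔
      (Sum.map (to (∥-pearl u∥U C)) (to (∥-pearl v∥V C)) ∘ ≈0-split (det (coord C) u) (det (coord C) v))
      Sum.[ ∣m⇒∣m*n (det (coord C) v) ∘ from (∥-pearl u∥U C) , ∣n⇒∣m*n (det (coord C) u) ∘ from (∥-pearl v∥V C) ]

    root⇔U-or-V : ∀ C → Root A B R S C ⇔ (C ≡ U ⊎ C ≡ V)
    root⇔U-or-V C = mk⇔
      (λ (_ , _ , jac≈0) → to jac⇔U-or-V jac≈0)
      (λ C∈UV → let jac≈0 = from jac⇔U-or-V C∈UV in
                (λ C≡A → jac-at-A≉0 (subst (λ X → jac A B R S X ≈0) C≡A jac≈0))
              , (λ C≡B → jac-at-B≉0 (subst (λ X → jac A B R S X ≈0) C≡B jac≈0))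
              , jac≈0)
      where
      jac⇔U-or-V : jac A B R S C ≈0 ⇔ (C ≡ U ⊎ C ≡ V)
      jac⇔U-or-V = ⇔-trans (jac⇔uv C) (uv≈0⇔U-or-V C)

    ∑-root : ∑[ C < suc p ] 𝟙 (root? A B R S C) ≡ 2
    ∑-root = ∑-𝟙-pair (root? A B R S) U≢V root⇔U-or-V

  ∑-root-square : ∀ {A B R S} → A ≢ B → CRSquare p A B R S → ∑[ C < suc p ] 𝟙 (root? A B R S C) ≡ 2
  ∑-root-square {A} {B} {R} {S} A≢B (_ , num≉0 , den≉0 , t , t-root) =
    SquareRoots.∑-root {A} {B} {R} {S} A≢B (num≉0 ∘ ∣⇒∣ᵤ) (den≉0 ∘ ∣⇒∣ᵤ) t (∣ᵤ⇒∣ t-root)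

  ∑-root-squarePair : ∀ {A B R S} → A ≢ B → SquarePair p A B R S → ∑[ C < suc p ] 𝟙 (root? A B R S C) ≡ 2
  ∑-root-squarePair {A} {B} {R} {S} A≢B (inj₁ sq) = ∑-root-square {A} {B} {R} {S} A≢B sq
  ∑-root-squarePair {A} {B} {R} {S} A≢B (inj₂ sq) =
    trans (∑-root-swap {A} {B} {R} {S}) (∑-root-square {A} {B} {S} {R} A≢B sq)

  root-avoids-pair : ∀ {A B R S C} → A ≢ B → ¬ (A ≡ R × B ≡ S) → ¬ (A ≡ S × B ≡ R) → Root A B R S C →
                     R ≢ A × R ≢ B × S ≢ A × S ≢ B
  root-avoids-pair {A} {B} {R} {S} {C} A≢B ≢AB ≢BA (C≢A , C≢B , jac≈0) = R≢A , R≢B , S≢A , S≢B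
    where
    -- jac ≈0 means Δ R A · Δ S A · Δ C B² ≈ Δ R B · Δ S B · Δ C A², so a vanishing factor on
    -- one side forces one on the other.
    RA*SA≈0⇒ : Δ R A * Δ S A ≈0 → Δ R B ≈0 ⊎ Δ S B ≈0 ⊎ Δ C A ≈0
    RA*SA≈0⇒ h = ≈0-split₃ (Δ R B) (Δ S B) (Δ C A) (to (≈0-diff-⇔ jac≈0) (∣m⇒∣m*n (Δ C B * Δ C B) h))
    RB*SB≈0⇒ : Δ R B * Δ S B ≈0 → Δ R A ≈0 ⊎ Δ S A ≈0 ⊎ Δ C B ≈0
    RB*SB≈0⇒ h = ≈0-split₃ (Δ R A) (Δ S A) (Δ C B) (from (≈0-diff-⇔ jac≈0) (∣m⇒∣m*n (Δ C A * Δ C A) h))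
    R≢A : R ≢ A
    R≢A R≡A = Sum.[ (λ RB → A≢B (trans (sym R≡A) (Δ-≈0⇒≡ R B RB)))
                  , Sum.[ (λ SB → ≢AB (sym R≡A , sym (Δ-≈0⇒≡ S B SB))) , C≢A ∘ Δ-≈0⇒≡ C A ] ]
                (RA*SA≈0⇒ (∣m⇒∣m*n (Δ S A) (≡⇒Δ-≈0 R≡A)))
    S≢A : S ≢ A
    S≢A S≡A = Sum.[ (λ RB → ≢BA (sym S≡A , sym (Δ-≈0⇒≡ R B RB)))
                  , Sum.[ (λ SB → A≢B (trans (sym S≡A) (Δ-≈0⇒≡ S B SB))) , C≢A ∘ Δ-≈0⇒≡ C A ] ]
                (RA*SA≈0⇒ (∣n⇒∣m*n (Δ R A) (≡⇒Δ-≈0 S≡A)))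
    R≢B : R ≢ B
    R≢B R≡B = Sum.[ (λ RA → A≢B (trans (sym (Δ-≈0⇒≡ R A RA)) R≡B))
                  , Sum.[ (λ SA → ≢BA (sym (Δ-≈0⇒≡ S A SA) , sym R≡B)) , C≢B ∘ Δ-≈0⇒≡ C B ] ]
                (RB*SB≈0⇒ (∣m⇒∣m*n (Δ S B) (≡⇒Δ-≈0 R≡B)))
    S≢B : S ≢ B
    S≢B S≡B = Sum.[ (λ RA → ≢AB (sym (Δ-≈0⇒≡ R A RA) , sym S≡B))
                  , Sum.[ (λ SA → A≢B (trans (sym (Δ-≈0⇒≡ S A SA)) S≡B)) , C≢B ∘ Δ-≈0⇒≡ C B ] ]
                (RB*SB≈0⇒ (∣n⇒∣m*n (Δ R B) (≡⇒Δ-≈0 S≡B)))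

  -- A root C gives the square root t = [ra][cb] / ([rb][ca]) of the cross-ratio.
  root⇒square : ∀ {A B R S C} → A ≢ B → R ≢ A × R ≢ B × S ≢ A × S ≢ B → Root A B R S C →
                CRSquare p A B R S
  root⇒square {A} {B} {R} {S} {C} A≢B (R≢A , R≢B , S≢A , S≢B) (C≢A , _ , jac≈0) =
    dec-true (¬? (A ≟ B) ×-dec ¬? (A ≟ R) ×-dec ¬? (B ≟ R)) (A≢B , R≢A ∘ sym , R≢B ∘ sym) ,
    ≉0-* (≢⇒Δ-≉0 R≢A) (≢⇒Δ-≉0 S≢B) ∘ ∣ᵤ⇒∣ ,
    ≉0-* (≢⇒Δ-≉0 R≢B) (≢⇒Δ-≉0 S≢A) ∘ ∣ᵤ⇒∣ ,
    Δ R A * Δ C B * y , ∣⇒∣ᵤ t-root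
    where
    RB*CA-inverse : ∃[ y ] Δ R B * Δ C A * y - 1ℤ ≈0
    RB*CA-inverse = inverse (≉0-* (≢⇒Δ-≉0 R≢B) (≢⇒Δ-≉0 C≢A))
    y = proj₁ RB*CA-inverse
    expand : ∀ α β γ δ P Q y →
             (α * Q * y) * (α * Q * y) * (β * γ) - α * δ
               ≡ y * y * (α * β) * (α * γ * (Q * Q) - β * δ * (P * P)) + α * δ * (β * P * y + 1ℤ) * (β * P * y - 1ℤ)
    expand = solve-∀
    t-root : (Δ R A * Δ C B * y) * (Δ R A * Δ C B * y) * (Δ R B * Δ S A) - Δ R A * Δ S B ≈0
    t-root = subst _≈0 (sym (expand (Δ R A) (Δ R B) (Δ S A) (Δ S B) (Δ C A) (Δ C B) y))
               (∣m∣n⇒∣m+n (∣n⇒∣m*n (y * y * (Δ R A * Δ R B)) jac≈0)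
                          (∣n⇒∣m*n (Δ R A * Δ S B * (Δ R B * Δ C A * y + 1ℤ)) (proj₂ RB*CA-inverse)))

  ∑-root-nonsquare : ∀ {A B R S} → A ≢ B → ¬ (A ≡ R × B ≡ S) → ¬ (A ≡ S × B ≡ R) → ¬ SquarePair p A B R S →
                     ∑[ C < suc p ] 𝟙 (root? A B R S C) ≡ 0
  ∑-root-nonsquare {A} {B} {R} {S} A≢B ≢AB ≢BA ¬sq =
    ∑-𝟙-empty (root? A B R S) λ C root → ¬sq (inj₁ (root⇒square A≢B (root-avoids-pair A≢B ≢AB ≢BA root) root))

mainTheorem16 : (p : ℕ) → Prime p → p % 2 ≡ 1 →
    (A B : Pearl p) → A < B →
    (R S : Pearl p) → R < S →
    ((A ≡ R × B ≡ S) → alpha2Coeff p A B R S ≡ (p ∸ 1) / 2)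
    × (¬ (A ≡ R × B ≡ S) → SquarePair p A B R S → alpha2Coeff p A B R S ≡ 1)
    × (¬ (A ≡ R × B ≡ S) → ¬ SquarePair p A B R S → alpha2Coeff p A B R S ≡ 0)
mainTheorem16 p p-prime p-odd A B A<B R S R<S =
    (λ { (refl , refl) → halve (∑-root-diagonal A≢B) })
  , (λ _ sq → halve (∑-root-squarePair A≢B sq))
  , (λ ≢AB ¬sq → halve (∑-root-nonsquare A≢B ≢AB ≢BA ¬sq))
  where
  open HarmonicPairs p p-prime p-odd
  A≢B : A ≢ B
  A≢B = <⇒≢ A<B
  ≢BA : ¬ (A ≡ S × B ≡ R)
  ≢BA (A≡S , B≡R) = <-asym A<B (subst₂ _<_ (sym B≡R) (sym A≡S) R<S)
  halve : ∀ {k} → ∑[ C < suc p ] 𝟙 (root? A B R S C) ≡ k → alpha2Coeff p A B R S ≡ k / 2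
  halve ∑≡k = trans (alpha2Coeff≡half A≢B (<⇒≢ R<S)) (cong (_/ 2) ∑≡k)
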